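{- Let $G=\{G^L\mid G^R\}$ be a composite game over a poset $A$ and $H$ any game over $A$. Then $H\triangleright G$ if and only if $G\equiv\{H,G^L\mid G^R\}$ (the game obtained from $G$ by adding $H$ as an additional left option). Dually, if $H=\{H^L\mid H^R\}$ is composite and $G$ is any game, then $H\triangleright G$ if and only if $H\equiv\{H^L\mid H^R,G\}$.
   Context: Games over a poset $A$: for each $a\in A$, $[a]$ is an atomic game; if $L,R$ are non-empty sets of games, $\{L\mid R\}$ is a composite game with left options $L$ and right options $R$; atomic games have no options; $\{H,G^L\mid G^R\}$ denotes the game with left options $\{H\}\cup\{\text{left options of }G\}$ and the same right options as $G$. Relations $\le,\triangleright$ by mutual recursion: $G\le H$ iff (1) every left option $G^L$ satisfies $G^L\triangleright H$, (2) every right option $H^R$ of $H$ satisfies $G\triangleright H^R$, (3) if $G$ or $H$ is atomic then $G\triangleright H$; $G\triangleright H$ iff (1) some right option $G^R$ of $G$ satisfies $G^R\le H$, or (2) some left option $H^L$ of $H$ satisfies $G\le H^L$, or (3) $G=[a],H=[b]$ are atomic and $a\le b$. $G\equiv H$ iff $G\le H$ and $H\le G$. -}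

module Defs where

open import Level using (Level; _⊔_) renaming (suc to lsuc; zero to lzero)
open import Data.Product using (Σ; Σ-syntax; _×_; _,_)
open import Data.Sum using (_⊎_; inj₁; inj₂)
open import Data.Maybe using (Maybe; just; nothing; maybe)
open import Relation.Binary.Bundles using (Poset)

-- Games over a poset P.  A composite game {L | R} is given by a non-empty
-- family of left options (index type I, options gl, witness of non-emptiness i₀)
-- and a non-empty family of right options (J, gr, j₀).
module GamesOver {c ℓ₁ ℓ₂ : Level} (P : Poset c ℓ₁ ℓ₂) where
  open Poset P renaming (Carrier to A; _≤_ to _≤A_)

  data Game : Set (c ⊔ lsuc lzero) where
    [_] : A → Game
    ⟨_,_,_∣_,_,_⟩ : (I : Set) → (I → Game) → I → (J : Set) → (J → Game) → J → Game

  -- For G ≤ H: (1) ∀ left options G^L, G^L ▷ H; (2) ∀ right options H^R, G ▷ H^R;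
  -- (3) if G or H is atomic, G ▷ H.  Vacuous clauses (atomic games have no
  -- options) are written as the empty conjunct omitted.
  infix 4 _≤g_ _▷_ _≡g_
  mutual
    _≤g_ : Game → Game → Set (ℓ₂ ⊔ c)
    [ a ] ≤g [ b ] = [ a ] ▷ [ b ]
    [ a ] ≤g H@(⟨ I , hl , i₀ ∣ J , hr , j₀ ⟩) =
      (∀ y → [ a ] ▷ hr y) × ([ a ] ▷ H)
    G@(⟨ I , gl , i₀ ∣ J , gr , j₀ ⟩) ≤g [ b ] =
      (∀ x → gl x ▷ [ b ]) × (G ▷ [ b ])
    G@(⟨ I , gl , i₀ ∣ J , gr , j₀ ⟩) ≤g H@(⟨ I' , hl , i₀' ∣ J' , hr , j₀' ⟩) =
      (∀ x → gl x ▷ H) × (∀ y → G ▷ hr y)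

    _▷_ : Game → Game → Set (ℓ₂ ⊔ c)
    [ a ] ▷ [ b ] = Level.Lift c (a ≤A b)
    G@([ a ]) ▷ ⟨ I' , hl , i₀' ∣ J' , hr , j₀' ⟩ = Σ[ x ∈ I' ] (G ≤g hl x)
    ⟨ I , gl , i₀ ∣ J , gr , j₀ ⟩ ▷ H@([ b ]) = Σ[ y ∈ J ] (gr y ≤g H)
    G@(⟨ I , gl , i₀ ∣ J , gr , j₀ ⟩) ▷ H@(⟨ I' , hl , i₀' ∣ J' , hr , j₀' ⟩) =
      (Σ[ y ∈ J ] (gr y ≤g H)) ⊎ (Σ[ x ∈ I' ] (G ≤g hl x))

  _≡g_ : Game → Game → Set (ℓ₂ ⊔ c)
  G ≡g H = (G ≤g H) × (H ≤g G)

  addLeft : Game → (I : Set) → (I → Game) → I → (J : Set) → (J → Game) → J → Game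
  addLeft H I gl i₀ J gr j₀ = ⟨ Maybe I , maybe gl H , just i₀ ∣ J , gr , j₀ ⟩

  addRight : Game → (I : Set) → (I → Game) → I → (J : Set) → (J → Game) → J → Game
  addRight G I hl i₀ J hr j₀ = ⟨ I , hl , i₀ ∣ Maybe J , maybe hr G , just j₀ ⟩

module Submission where

open import Defs
open import Level using (Level; lift)
open import Relation.Binary.Bundles using (Poset)
open import Data.Product using (_×_; _,_; proj₁; proj₂)
open import Data.Sum using (inj₁; inj₂)
open import Data.Maybe using (Maybe; just; nothing; maybe)
open import Function.Bundles using (_⇔_; mk⇔)

-- By reflexivity of ≤, every old option of G is matched by itself, so adding a
-- left option H never hurts Left: G ≤ {H, G^L | G^R} always.  The reverse
-- inequality unfolds to G^L ▷ G for the old left options (reflexivity again)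
-- and H ▷ G for the new one.

module _ {c ℓ₁ ℓ₂ : Level} (P : Poset c ℓ₁ ℓ₂) where
  open GamesOver P

  ▷-leftOption : ∀ {K I hl i₀ J hr j₀} (x : I) →
    K ≤g hl x → K ▷ ⟨ I , hl , i₀ ∣ J , hr , j₀ ⟩
  ▷-leftOption {[ _ ]} x K≤hlx = x , K≤hlx
  ▷-leftOption {⟨ _ , _ , _ ∣ _ , _ , _ ⟩} x K≤hlx = inj₂ (x , K≤hlx)

  ▷-rightOption : ∀ {K I gl i₀ J gr j₀} (y : J) →
    gr y ≤g K → ⟨ I , gl , i₀ ∣ J , gr , j₀ ⟩ ▷ K
  ▷-rightOption {[ _ ]} y gry≤K = y , gry≤K
  ▷-rightOption {⟨ _ , _ , _ ∣ _ , _ , _ ⟩} y gry≤K = inj₁ (y , gry≤K)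

  ≤g-refl : ∀ K → K ≤g K
  ≤g-refl [ _ ] = lift (Poset.refl P)
  ≤g-refl ⟨ I , gl , i₀ ∣ J , gr , j₀ ⟩ =
    (λ x → ▷-leftOption x (≤g-refl (gl x))) , (λ y → ▷-rightOption y (≤g-refl (gr y)))

  module _ (I : Set) (gl : I → Game) (i₀ : I) (J : Set) (gr : J → Game) (j₀ : J) where
    private
      G : Game
      G = ⟨ I , gl , i₀ ∣ J , gr , j₀ ⟩

    ≤g-addLeft : ∀ H → G ≤g addLeft H I gl i₀ J gr j₀
    ≤g-addLeft H =
      (λ x → ▷-leftOption (just x) (≤g-refl (gl x))) , (λ y → ▷-rightOption y (≤g-refl (gr y)))

    addLeft-≤g : ∀ {H} → H ▷ G → addLeft H I gl i₀ J gr j₀ ≤g G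
    addLeft-≤g {H} H▷G = left-options , (λ y → ▷-rightOption y (≤g-refl (gr y)))
      where
      left-options : (x : Maybe I) → maybe gl H x ▷ G
      left-options (just x) = ▷-leftOption x (≤g-refl (gl x))
      left-options nothing = H▷G

    addRight-≤g : ∀ K → addRight K I gl i₀ J gr j₀ ≤g G
    addRight-≤g K =
      (λ x → ▷-leftOption x (≤g-refl (gl x))) , (λ y → ▷-rightOption (just y) (≤g-refl (gr y)))

    ≤g-addRight : ∀ {K} → G ▷ K → G ≤g addRight K I gl i₀ J gr j₀
    ≤g-addRight {K} G▷K = (λ x → ▷-leftOption x (≤g-refl (gl x))) , right-options
      where
      right-options : (y : Maybe J) → G ▷ maybe gr K y
      right-options (just y) = ▷-rightOption y (≤g-refl (gr y))
      right-options nothing = G▷K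

    ▷⇔≡g-addLeft : ∀ H → (H ▷ G) ⇔ (G ≡g addLeft H I gl i₀ J gr j₀)
    ▷⇔≡g-addLeft H = mk⇔ (λ H▷G → ≤g-addLeft H , addLeft-≤g H▷G)
                         (λ G≡G+H → proj₁ (proj₂ G≡G+H) nothing)

    ▷⇔≡g-addRight : ∀ K → (G ▷ K) ⇔ (G ≡g addRight K I gl i₀ J gr j₀)
    ▷⇔≡g-addRight K = mk⇔ (λ G▷K → ≤g-addRight G▷K , addRight-≤g K)
                          (λ G≡G+K → proj₂ (proj₁ G≡G+K) nothing)

lemma4p10 : {c ℓ₁ ℓ₂ : Level} (P : Poset c ℓ₁ ℓ₂) → let open GamesOver P in
    ((I : Set) (gl : I → Game) (i₀ : I) (J : Set) (gr : J → Game) (j₀ : J) (H : Game) →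
      (H ▷ ⟨ I , gl , i₀ ∣ J , gr , j₀ ⟩) ⇔ (⟨ I , gl , i₀ ∣ J , gr , j₀ ⟩ ≡g addLeft H I gl i₀ J gr j₀))
    × ((I : Set) (hl : I → Game) (i₀ : I) (J : Set) (hr : J → Game) (j₀ : J) (G : Game) →
      (⟨ I , hl , i₀ ∣ J , hr , j₀ ⟩ ▷ G) ⇔ (⟨ I , hl , i₀ ∣ J , hr , j₀ ⟩ ≡g addRight G I hl i₀ J hr j₀))
lemma4p10 P = ▷⇔≡g-addLeft P , ▷⇔≡g-addRight P
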